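{- Let $A \in \mathbb{F}_2[x]$ be nonzero with Collatz sequence $(A_j)_{j\geq 0}$, and put $d_k = \deg(A_{2k})$, $\ell_k = \deg(A_{2k+1})$. Then the sequences $(\ell_k)_k$ and $(d_k)_k$ converge, with limits $\ell$ and $d$ respectively, and $d = \ell + 2$.
   Context: A polynomial $S \in \mathbb{F}_2[x]$ is called odd if $\gcd(S, x(x+1)) = 1$. Let $M_1 = x^2+x+1$. For nonzero $S$, $val_x(S)$ and $val_{x+1}(S)$ denote the exponents of $x$ and $x+1$ in $S$. For nonzero $A \in \mathbb{F}_2[x]$ define: $A_0 = A$; for every $k \geq 0$, $a_{2k} = val_x(A_{2k})$, $b_{2k} = val_{x+1}(A_{2k})$, $A_{2k+1} = A_{2k}/(x^{a_{2k}}(x+1)^{b_{2k}})$ (odd); and $A_{2k+2} = 1 + M_1 A_{2k+1}$. -}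

module Defs where

open import Data.Bool using (Bool; true; false; if_then_else_; _xor_; not)
open import Data.List using (List; []; _∷_; length)
open import Data.Nat using (ℕ; zero; suc; _∸_)
open import Data.Product using (_×_; _,_; proj₁; proj₂)
open import Relation.Binary.PropositionalEquality using (_≢_)

-- Polynomials over F₂ as coefficient lists, little-endian:
-- b₀ ∷ b₁ ∷ … ∷ bₙ ∷ [] represents b₀ + b₁ x + … + bₙ xⁿ.
-- Trailing 'false's are allowed in the representation; every operation
-- below normalises, so all notions depend only on the polynomial.
Poly : Set
Poly = List Bool

cons′ : Bool → Poly → Poly
cons′ b [] = if b then true ∷ [] else []
cons′ b (c ∷ p) = b ∷ c ∷ p

norm : Poly → Poly
norm [] = []
norm (b ∷ p) = cons′ b (norm p)

NonZeroPoly : Poly → Set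
NonZeroPoly p = norm p ≢ []

isZero : Poly → Bool
isZero p with norm p
... | [] = true
... | _ ∷ _ = false

addRaw : Poly → Poly → Poly
addRaw [] q = q
addRaw (a ∷ p) [] = a ∷ p
addRaw (a ∷ p) (b ∷ q) = (a xor b) ∷ addRaw p q

_⊕_ : Poly → Poly → Poly
p ⊕ q = norm (addRaw p q)

mulRaw : Poly → Poly → Poly
mulRaw [] q = []
mulRaw (b ∷ p) q = addRaw (if b then q else []) (false ∷ mulRaw p q)

_⊗_ : Poly → Poly → Poly
p ⊗ q = norm (mulRaw p q)

𝟙 : Poly
𝟙 = true ∷ []

M₁ : Poly
M₁ = true ∷ true ∷ true ∷ []

-- degree (deg 0 := 0 by convention; only used on nonzero polynomials)
deg : Poly → ℕ
deg p = length (norm p) ∸ 1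

valXn : Poly → ℕ
valXn [] = 0
valXn (true ∷ p) = 0
valXn (false ∷ p) = suc (valXn p)

valX : Poly → ℕ
valX p = valXn (norm p)

divX : Poly → Poly
divX [] = []
divX (b ∷ p) = norm p

-- Division by x+1:  divModX1 p = (q , r)  with  p = (1+x) q + r

divModX1 : Poly → Poly × Bool
divModX1 [] = [] , false
divModX1 (b ∷ p) with divModX1 p
... | q , r = norm (r ∷ q) , (r xor b)

divX1 : Poly → Poly
divX1 p = proj₁ (divModX1 p)

dvdX1 : Poly → Bool
dvdX1 p = not (proj₂ (divModX1 p))

-- valuation at x+1 with fuel (fuel = length suffices, as the degree drops)
valX1F : ℕ → Poly → ℕ
valX1F zero p = 0
valX1F (suc n) p =
  if isZero p then 0 else (if dvdX1 p then suc (valX1F n (divX1 p)) else 0)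

valX1 : Poly → ℕ
valX1 p = valX1F (length p) (norm p)

divXPow : ℕ → Poly → Poly
divXPow zero p = norm p
divXPow (suc n) p = divXPow n (divX (norm p))

divX1Pow : ℕ → Poly → Poly
divX1Pow zero p = norm p
divX1Pow (suc n) p = divX1Pow n (divX1 (norm p))

oddPart : Poly → Poly
oddPart S = divX1Pow (valX1 S) (divXPow (valX S) S)

-- The Collatz sequence:  evenTerm A k = A_{2k},  oddTerm A k = A_{2k+1}

evenTerm : Poly → ℕ → Poly
oddTerm  : Poly → ℕ → Poly
evenTerm A zero = norm A
evenTerm A (suc k) = 𝟙 ⊕ (M₁ ⊗ oddTerm A k)
oddTerm A k = oddPart (evenTerm A k)

open import Data.Nat using (_≤_)
open import Relation.Binary.PropositionalEquality using (_≡_)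
open import Data.Product using (Σ; ∃-syntax)

ConvergesTo : (ℕ → ℕ) → ℕ → Set
ConvergesTo u L = ∃[ N ] ((k : ℕ) → N ≤ k → u k ≡ L)

{-# OPTIONS --safe #-}
-- For odd T, the polynomial S = 1 + M₁ T vanishes at 0 and at 1 (as M₁(0) = M₁(1) = 1), so
-- x(x+1) ∣ S, while deg S = deg T + 2; hence the next odd term, the odd part of S, has
-- degree at most deg T. The odd terms are therefore an orbit of T ↦ oddPart (1 + M₁ T)
-- inside the finite set of polynomials of degree at most deg A₁. By pigeonhole the orbit
-- repeats a value and is periodic from then on; its degrees are non-increasing and
-- periodic, hence constant, and the even degrees follow as ℓ + 2.
module Submission where

open import Algebra.Bundles using (CommutativeRing)
open import Data.Bool using (Bool; true; false; _∧_; _xor_; if_then_else_)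
open import Data.Bool.Properties
  using (xor-identityʳ; xor-comm; ∧-distribʳ-xor; not-injective; xor-∧-commutativeRing)
open import Algebra.Properties.CommutativeSemigroup
  (CommutativeRing.+-commutativeSemigroup xor-∧-commutativeRing) using (interchange)
open import Data.Empty using (⊥-elim)
open import Data.List using ([]; _∷_; length)
open import Data.Fin using (toℕ; fromℕ<)
open import Data.Fin.Properties using (pigeonhole; toℕ-fromℕ<)
open import Data.Nat using (ℕ; zero; suc; _+_; _*_; _∸_; _^_; _≤_; _<_; z≤n; s≤s)
open import Data.Nat.DivMod using (_%_; [m+kn]%n≡m%n; m<n⇒m%n≡m)
open import Data.Nat.Properties
open import Data.Sum using (inj₁; inj₂)
open import Data.Product using (_×_; _,_; proj₁; proj₂; ∃-syntax)
open import Relation.Binary.PropositionalEquality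

open import Defs

data Normal : Poly → Set where
  nil  : Normal []
  one  : Normal (true ∷ [])
  cons : ∀ b {c p} → Normal (c ∷ p) → Normal (b ∷ c ∷ p)

normal-cons′ : ∀ b {p} → Normal p → Normal (cons′ b p)
normal-cons′ true  nil = one
normal-cons′ false nil = nil
normal-cons′ b {_ ∷ _} h = cons b h

normal-norm : ∀ p → Normal (norm p)
normal-norm []      = nil
normal-norm (b ∷ p) = normal-cons′ b (normal-norm p)

norm-normal : ∀ {p} → Normal p → norm p ≡ p
norm-normal nil        = refl
norm-normal one        = refl
norm-normal (cons b h) = cong (cons′ b) (norm-normal h)

norm-idem : ∀ p → norm (norm p) ≡ norm p
norm-idem p = norm-normal (normal-norm p)

nonZero-∷ : ∀ {b p} → Normal (b ∷ p) → NonZeroPoly (b ∷ p)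
nonZero-∷ h eq with () ← trans (sym (norm-normal h)) eq

cons′-true : ∀ p → cons′ true p ≡ true ∷ p
cons′-true []      = refl
cons′-true (_ ∷ _) = refl

length-cons′ : ∀ b p → length (cons′ b p) ≤ suc (length p)
length-cons′ true  []      = ≤-refl
length-cons′ false []      = z≤n
length-cons′ b     (_ ∷ _) = ≤-refl

length-norm : ∀ p → length (norm p) ≤ length p
length-norm []      = z≤n
length-norm (b ∷ p) = ≤-trans (length-cons′ b (norm p)) (s≤s (length-norm p))

length-addRaw : ∀ {n} p q → length p ≤ n → length q ≤ n → length (addRaw p q) ≤ n
length-addRaw []      q       _         q≤n       = q≤n
length-addRaw (a ∷ p) []      p≤n       _         = p≤n
length-addRaw (a ∷ p) (b ∷ q) (s≤s p≤n) (s≤s q≤n) = s≤s (length-addRaw p q p≤n q≤n)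

length-mulRaw : ∀ p c q → length (mulRaw p (c ∷ q)) ≤ length p + length q
length-mulRaw []      c q = z≤n
length-mulRaw (b ∷ p) c q =
  length-addRaw (if b then c ∷ q else []) _ (scaled b) (s≤s (length-mulRaw p c q))
  where
  scaled : ∀ b → length (if b then c ∷ q else []) ≤ suc (length p + length q)
  scaled true  = s≤s (m≤n+m (length q) (length p))
  scaled false = z≤n

coef : Poly → ℕ → Bool
coef []      _       = false
coef (b ∷ _) zero    = b
coef (_ ∷ p) (suc i) = coef p i

coef-cons′ : ∀ b p i → coef (cons′ b p) i ≡ coef (b ∷ p) i
coef-cons′ true  []      _       = refl
coef-cons′ false []      zero    = refl
coef-cons′ false []      (suc _) = refl
coef-cons′ _     (_ ∷ _) _       = refl

coef-norm : ∀ p i → coef (norm p) i ≡ coef p i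
coef-norm []      _       = refl
coef-norm (b ∷ p) zero    = coef-cons′ b (norm p) zero
coef-norm (b ∷ p) (suc i) = trans (coef-cons′ b (norm p) (suc i)) (coef-norm p i)

coef-addRaw : ∀ p q i → coef (addRaw p q) i ≡ coef p i xor coef q i
coef-addRaw []      _       _       = refl
coef-addRaw (_ ∷ _) []      _       = sym (xor-identityʳ _)
coef-addRaw (_ ∷ _) (_ ∷ _) zero    = refl
coef-addRaw (_ ∷ p) (_ ∷ q) (suc i) = coef-addRaw p q i

coef-⊕ : ∀ p q i → coef (p ⊕ q) i ≡ coef p i xor coef q i
coef-⊕ p q i = trans (coef-norm (addRaw p q) i) (coef-addRaw p q i)

coef₀-mulRaw : ∀ p q → coef (mulRaw p q) 0 ≡ coef p 0 ∧ coef q 0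
coef₀-mulRaw []          q = refl
coef₀-mulRaw (true  ∷ p) q = trans (coef-addRaw q _ 0) (xor-identityʳ _)
coef₀-mulRaw (false ∷ p) q = refl

coef₀-⊗ : ∀ p q → coef (p ⊗ q) 0 ≡ coef p 0 ∧ coef q 0
coef₀-⊗ p q = trans (coef-norm (mulRaw p q) 0) (coef₀-mulRaw p q)

coef-true⇒<length : ∀ p i → coef p i ≡ true → i < length p
coef-true⇒<length (_ ∷ _) zero    _  = s≤s z≤n
coef-true⇒<length (_ ∷ p) (suc i) eq = s≤s (coef-true⇒<length p i eq)

coef-≥length : ∀ p i → length p ≤ i → coef p i ≡ false
coef-≥length []      _       _         = refl
coef-≥length (_ ∷ p) (suc i) (s≤s p≤i) = coef-≥length p i p≤i

coef-leading : ∀ {b p} → Normal (b ∷ p) → coef (b ∷ p) (length p) ≡ true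
coef-leading one        = refl
coef-leading (cons _ h) = coef-leading h

-- parity p is the value p(1), so (x+1) ∣ p iff parity p ≡ false.
parity : Poly → Bool
parity []      = false
parity (b ∷ p) = b xor parity p

parity-cons′ : ∀ b p → parity (cons′ b p) ≡ b xor parity p
parity-cons′ true  []      = refl
parity-cons′ false []      = refl
parity-cons′ _     (_ ∷ _) = refl

parity-norm : ∀ p → parity (norm p) ≡ parity p
parity-norm []      = refl
parity-norm (b ∷ p) = trans (parity-cons′ b (norm p)) (cong (b xor_) (parity-norm p))

parity-addRaw : ∀ p q → parity (addRaw p q) ≡ parity p xor parity q
parity-addRaw []      _       = refl
parity-addRaw (_ ∷ _) []      = sym (xor-identityʳ _)
parity-addRaw (a ∷ p) (b ∷ q) =
  trans (cong ((a xor b) xor_) (parity-addRaw p q)) (interchange a b (parity p) (parity q))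

parity-⊕ : ∀ p q → parity (p ⊕ q) ≡ parity p xor parity q
parity-⊕ p q = trans (parity-norm (addRaw p q)) (parity-addRaw p q)

parity-mulRaw : ∀ p q → parity (mulRaw p q) ≡ parity p ∧ parity q
parity-mulRaw []      q = refl
parity-mulRaw (b ∷ p) q = begin
  parity (addRaw (if b then q else []) (false ∷ mulRaw p q))
    ≡⟨ parity-addRaw (if b then q else []) _ ⟩
  parity (if b then q else []) xor parity (mulRaw p q)
    ≡⟨ cong₂ _xor_ (scaled b) (parity-mulRaw p q) ⟩
  (b ∧ parity q) xor (parity p ∧ parity q)
    ≡⟨ ∧-distribʳ-xor (parity q) b (parity p) ⟨
  (b xor parity p) ∧ parity q ∎
  where
  open ≡-Reasoning
  scaled : ∀ b → parity (if b then q else []) ≡ b ∧ parity q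
  scaled true  = refl
  scaled false = refl

parity-⊗ : ∀ p q → parity (p ⊗ q) ≡ parity p ∧ parity q
parity-⊗ p q = trans (parity-norm (mulRaw p q)) (parity-mulRaw p q)

divModX1-∷ : ∀ b p →
  divModX1 (b ∷ p) ≡ (norm (proj₂ (divModX1 p) ∷ divX1 p) , proj₂ (divModX1 p) xor b)
divModX1-∷ b p with divModX1 p
... | _ , _ = refl

remainderX1≡parity : ∀ p → proj₂ (divModX1 p) ≡ parity p
remainderX1≡parity []      = refl
remainderX1≡parity (b ∷ p) = begin
  proj₂ (divModX1 (b ∷ p))       ≡⟨ cong proj₂ (divModX1-∷ b p) ⟩
  proj₂ (divModX1 p) xor b       ≡⟨ cong (_xor b) (remainderX1≡parity p) ⟩
  parity p xor b                 ≡⟨ xor-comm (parity p) b ⟩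
  b xor parity p                 ∎
  where open ≡-Reasoning

divX1-∷ : ∀ b p → divX1 (b ∷ p) ≡ norm (parity p ∷ divX1 p)
divX1-∷ b p = trans (cong proj₁ (divModX1-∷ b p))
                    (cong (λ r → norm (r ∷ divX1 p)) (remainderX1≡parity p))

normal-divX1 : ∀ p → Normal (divX1 p)
normal-divX1 []      = nil
normal-divX1 (b ∷ p) = subst Normal (sym (divX1-∷ b p)) (normal-norm (parity p ∷ divX1 p))

length-divX1 : ∀ b p → length (divX1 (b ∷ p)) ≤ length p
length-divX1 b []      = z≤n
length-divX1 b (c ∷ p) = begin
  length (divX1 (b ∷ c ∷ p))                    ≡⟨ cong length (divX1-∷ b (c ∷ p)) ⟩
  length (norm (parity (c ∷ p) ∷ divX1 (c ∷ p))) ≤⟨ length-norm (parity (c ∷ p) ∷ divX1 (c ∷ p)) ⟩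
  suc (length (divX1 (c ∷ p)))                  ≤⟨ s≤s (length-divX1 c p) ⟩
  suc (length p)                                ∎
  where open ≤-Reasoning

divX1-∷-cons′ : ∀ b p → divX1 (b ∷ p) ≡ cons′ (parity p) (divX1 p)
divX1-∷-cons′ b p = trans (divX1-∷ b p) (cong (cons′ (parity p)) (norm-normal (normal-divX1 p)))

divX1-true∷ : ∀ p → parity (true ∷ p) ≡ false → divX1 (true ∷ p) ≡ true ∷ divX1 p
divX1-true∷ p x+1∣ = trans (divX1-∷-cons′ true p)
  (trans (cong (λ r → cons′ r (divX1 p)) (not-injective x+1∣)) (cons′-true (divX1 p)))

divX1-false∷ : ∀ p → parity p ≡ false → divX1 (false ∷ p) ≡ cons′ false (divX1 p)
divX1-false∷ p x+1∣ = trans (divX1-∷-cons′ false p) (cong (λ r → cons′ r (divX1 p)) x+1∣)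

isZero-nonZero : ∀ p → NonZeroPoly p → isZero p ≡ false
isZero-nonZero p p≢0 with norm p
... | []    = ⊥-elim (p≢0 refl)
... | _ ∷ _ = refl

valX1F-suc : ∀ n {b p} → Normal (b ∷ p) →
  valX1F (suc n) (b ∷ p) ≡ (if parity (b ∷ p) then 0 else suc (valX1F n (divX1 (b ∷ p))))
valX1F-suc n {b} {p} h
  rewrite isZero-nonZero (b ∷ p) (nonZero-∷ h) | remainderX1≡parity (b ∷ p)
  with parity (b ∷ p)
... | true  = refl
... | false = refl

valX1F-x* : ∀ n {p} → Normal p → valX1F n (cons′ false p) ≡ valX1F n p
valX1F-x* zero    _ = refl
valX1F-x* (suc n) nil = refl
valX1F-x* (suc n) {c ∷ p} h
  rewrite valX1F-suc n (cons false h) | valX1F-suc n h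
  with parity (c ∷ p) in x+1∣
... | true  = refl
... | false = cong suc (begin
  valX1F n (divX1 (false ∷ c ∷ p))       ≡⟨ cong (valX1F n) (divX1-false∷ (c ∷ p) x+1∣) ⟩
  valX1F n (cons′ false (divX1 (c ∷ p))) ≡⟨ valX1F-x* n (normal-divX1 (c ∷ p)) ⟩
  valX1F n (divX1 (c ∷ p))               ∎)
  where open ≡-Reasoning

-- gcd (p , x(x+1)) = 1 iff p(0) = p(1) = 1.
data Odd : Poly → Set where
  odd : ∀ {p} → Normal (true ∷ p) → parity (true ∷ p) ≡ true → Odd (true ∷ p)

normal-odd : ∀ {p} → Odd p → Normal p
normal-odd (odd h _) = h

-- XFactorisation p a q  says  p = x^a (1 + x q),  with p in normal form.
data XFactorisation : Poly → ℕ → Poly → Set where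
  unit    : ∀ {q} → Normal (true ∷ q) → XFactorisation (true ∷ q) 0 q
  times-x : ∀ {c p a q} → XFactorisation (c ∷ p) a q → XFactorisation (false ∷ c ∷ p) (suc a) q

xFactorisation : ∀ {p} → Normal p → NonZeroPoly p → ∃[ a ] ∃[ q ] XFactorisation p a q
xFactorisation nil            p≢0 = ⊥-elim (p≢0 refl)
xFactorisation one            _   = 0 , [] , unit one
xFactorisation (cons true h)  _   = 0 , _ , unit (cons true h)
xFactorisation (cons false h) _ with xFactorisation h (nonZero-∷ h)
... | a , q , f = suc a , q , times-x f

module _ {q : Poly} where

  normal-xFactorisation : ∀ {p a} → XFactorisation p a q → Normal p
  normal-xFactorisation (unit h)    = h
  normal-xFactorisation (times-x f) = cons false (normal-xFactorisation f)

  normal-xFree : ∀ {p a} → XFactorisation p a q → Normal (true ∷ q)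
  normal-xFree (unit h)    = h
  normal-xFree (times-x f) = normal-xFree f

  valXn-xFactorisation : ∀ {p a} → XFactorisation p a q → valXn p ≡ a
  valXn-xFactorisation (unit _)    = refl
  valXn-xFactorisation (times-x f) = cong suc (valXn-xFactorisation f)

  length-xFactorisation : ∀ {p a} → XFactorisation p a q → length (true ∷ q) + a ≡ length p
  length-xFactorisation (unit _)    = +-identityʳ _
  length-xFactorisation {a = suc a} (times-x f) =
    trans (+-suc (length (true ∷ q)) a) (cong suc (length-xFactorisation f))

  divXPow-xFactorisation : ∀ {p a} → XFactorisation p a q → divXPow a p ≡ true ∷ q
  divXPow-xFactorisation (unit h) = norm-normal h
  divXPow-xFactorisation {false ∷ c ∷ p} {suc a} (times-x f) = begin
    divXPow a (divX (norm (false ∷ c ∷ p))) ≡⟨ cong (λ r → divXPow a (divX r)) (norm-normal (normal-xFactorisation (times-x f))) ⟩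
    divXPow a (norm (c ∷ p))                ≡⟨ cong (divXPow a) (norm-normal (normal-xFactorisation f)) ⟩
    divXPow a (c ∷ p)                       ≡⟨ divXPow-xFactorisation f ⟩
    true ∷ q                                ∎
    where open ≡-Reasoning

  valX1F-xFactorisation : ∀ n {p a} → XFactorisation p a q → valX1F n p ≡ valX1F n (true ∷ q)
  valX1F-xFactorisation n (unit _)    = refl
  valX1F-xFactorisation n (times-x f) = trans (valX1F-x* n (normal-xFactorisation f)) (valX1F-xFactorisation n f)

OddQuotientX1 : Poly → ℕ → Set
OddQuotientX1 p b = Odd (divX1Pow b p) × length (divX1Pow b p) + b ≤ length p

oddQuotientX1-suc : ∀ {p b} → Normal p → length (divX1 p) < length p →
                    OddQuotientX1 (divX1 p) b → OddQuotientX1 p (suc b)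
oddQuotientX1-suc {p} {b} h shorter (quotient-odd , quotient-short) =
  subst Odd (sym divX1Pow-suc) quotient-odd , (begin
    length (divX1Pow (suc b) p) + suc b     ≡⟨ cong (λ r → length r + suc b) divX1Pow-suc ⟩
    length (divX1Pow b (divX1 p)) + suc b   ≡⟨ +-suc _ b ⟩
    suc (length (divX1Pow b (divX1 p)) + b) ≤⟨ s≤s quotient-short ⟩
    suc (length (divX1 p))                  ≤⟨ shorter ⟩
    length p                                ∎)
  where
  open ≤-Reasoning
  divX1Pow-suc : divX1Pow (suc b) p ≡ divX1Pow b (divX1 p)
  divX1Pow-suc = cong (λ r → divX1Pow b (divX1 r)) (norm-normal h)

oddQuotientX1-valX1F : ∀ n {q} → Normal (true ∷ q) → length (true ∷ q) ≤ n →
                       OddQuotientX1 (true ∷ q) (valX1F n (true ∷ q))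
oddQuotientX1-valX1F (suc n) {q} h (s≤s short)
  rewrite valX1F-suc n h
  with parity (true ∷ q) in x+1∣
... | true  = subst (λ r → Odd r × length r + 0 ≤ length (true ∷ q)) (sym (norm-normal h))
                    (odd h x+1∣ , ≤-reflexive (+-identityʳ _))
... | false = oddQuotientX1-suc h (s≤s (length-divX1 true q))
                (subst (λ r → OddQuotientX1 r (valX1F n r)) (sym quotient)
                       (oddQuotientX1-valX1F n quotient-normal quotient-short))
  where
  quotient : divX1 (true ∷ q) ≡ true ∷ divX1 q
  quotient = divX1-true∷ q x+1∣
  quotient-normal : Normal (true ∷ divX1 q)
  quotient-normal = subst Normal quotient (normal-divX1 (true ∷ q))
  quotient-short : length (true ∷ divX1 q) ≤ n
  quotient-short = subst (λ r → length r ≤ n) quotient (≤-trans (length-divX1 true q) short)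

divXPow-norm : ∀ a p → divXPow a (norm p) ≡ divXPow a p
divXPow-norm zero    p = norm-idem p
divXPow-norm (suc a) p = cong (λ r → divXPow a (divX r)) (norm-idem p)

nonZero-norm : ∀ {p} → NonZeroPoly p → NonZeroPoly (norm p)
nonZero-norm {p} p≢0 eq = p≢0 (trans (sym (norm-idem p)) eq)

module OddPart (S : Poly) (S≢0 : NonZeroPoly S) where

  private
    factorisation : ∃[ a ] ∃[ q ] XFactorisation (norm S) a q
    factorisation = xFactorisation (normal-norm S) (nonZero-norm {S} S≢0)

    a : ℕ
    a = proj₁ factorisation

    q : Poly
    q = proj₁ (proj₂ factorisation)

    f : XFactorisation (norm S) a q
    f = proj₂ (proj₂ factorisation)

    b : ℕ
    b = valX1F (length S) (true ∷ q)

    valX1≡ : valX1 S ≡ b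
    valX1≡ = valX1F-xFactorisation (length S) f

    valX≡ : valX S ≡ a
    valX≡ = valXn-xFactorisation f

    oddPart≡ : oddPart S ≡ divX1Pow b (true ∷ q)
    oddPart≡ = cong₂ divX1Pow valX1≡ (begin
      divXPow (valX S) S   ≡⟨ cong (λ c → divXPow c S) valX≡ ⟩
      divXPow a S          ≡⟨ divXPow-norm a S ⟨
      divXPow a (norm S)   ≡⟨ divXPow-xFactorisation f ⟩
      true ∷ q             ∎)
      where open ≡-Reasoning

    quotient : OddQuotientX1 (true ∷ q) b
    quotient = oddQuotientX1-valX1F (length S) (normal-xFree f) (begin
      length (true ∷ q)     ≤⟨ m≤m+n (length (true ∷ q)) a ⟩
      length (true ∷ q) + a ≡⟨ length-xFactorisation f ⟩
      length (norm S)       ≤⟨ length-norm S ⟩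
      length S              ∎)
      where open ≤-Reasoning

  odd-oddPart : Odd (oddPart S)
  odd-oddPart = subst Odd (sym oddPart≡) (proj₁ quotient)

  length-oddPart : length (oddPart S) + valX1 S + valX S ≤ length (norm S)
  length-oddPart = begin
    length (oddPart S) + valX1 S + valX S
      ≡⟨ cong₂ _+_ (cong₂ _+_ (cong length oddPart≡) valX1≡) valX≡ ⟩
    length (divX1Pow b (true ∷ q)) + b + a ≤⟨ +-monoˡ-≤ a (proj₂ quotient) ⟩
    length (true ∷ q) + a                  ≡⟨ length-xFactorisation f ⟩
    length (norm S)                        ∎
    where open ≤-Reasoning

valX-pos : ∀ {p} → Normal p → NonZeroPoly p → coef p 0 ≡ false → 1 ≤ valX p
valX-pos {[]}        _ p≢0 _ = ⊥-elim (p≢0 refl)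
valX-pos {false ∷ p} h _   _ = subst (λ r → 1 ≤ valXn r) (sym (norm-normal h)) (s≤s z≤n)

valX1-pos : ∀ {p} → Normal p → NonZeroPoly p → parity p ≡ false → 1 ≤ valX1 p
valX1-pos {[]}    _ p≢0 _ = ⊥-elim (p≢0 refl)
valX1-pos {b ∷ p} h _   x+1∣ =
  subst (λ r → 1 ≤ valX1F (suc (length p)) r) (sym (norm-normal h))
        (subst (1 ≤_) (sym (valX1F-suc (length p) h)) dividing)
  where
  dividing : 1 ≤ (if parity (b ∷ p) then 0 else suc (valX1F (length p) (divX1 (b ∷ p))))
  dividing rewrite x+1∣ = s≤s z≤n

coef-M₁* : ∀ p i → coef (mulRaw M₁ p) (suc (suc i)) ≡ coef p (suc (suc i)) xor (coef p (suc i) xor coef p i)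
coef-M₁* p i = begin
  coef (mulRaw M₁ p) (2 + i)
    ≡⟨ coef-addRaw p _ (2 + i) ⟩
  coef p (2 + i) xor coef (addRaw p (false ∷ addRaw p (false ∷ []))) (1 + i)
    ≡⟨ cong (coef p (2 + i) xor_) (coef-addRaw p _ (1 + i)) ⟩
  coef p (2 + i) xor (coef p (1 + i) xor coef (addRaw p (false ∷ [])) i)
    ≡⟨ cong (λ c → coef p (2 + i) xor (coef p (1 + i) xor c)) (coef-addRaw-zero i) ⟩
  coef p (2 + i) xor (coef p (1 + i) xor coef p i) ∎
  where
  open ≡-Reasoning
  coef-addRaw-zero : ∀ i → coef (addRaw p (false ∷ [])) i ≡ coef p i
  coef-addRaw-zero zero    = trans (coef-addRaw p _ 0) (xor-identityʳ _)
  coef-addRaw-zero (suc j) = trans (coef-addRaw p _ (suc j)) (xor-identityʳ _)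

coef₀-1+M₁* : ∀ {T} → Odd T → coef (𝟙 ⊕ (M₁ ⊗ T)) 0 ≡ false
coef₀-1+M₁* {true ∷ t} _ =
  trans (coef-⊕ 𝟙 (M₁ ⊗ (true ∷ t)) 0) (cong (true xor_) (coef₀-⊗ M₁ (true ∷ t)))

parity-1+M₁* : ∀ {T} → Odd T → parity (𝟙 ⊕ (M₁ ⊗ T)) ≡ false
parity-1+M₁* {T} (odd _ T∤) =
  trans (parity-⊕ 𝟙 (M₁ ⊗ T)) (cong (true xor_) (trans (parity-⊗ M₁ T) T∤))

length-1+M₁* : ∀ {T} → Odd T → length (𝟙 ⊕ (M₁ ⊗ T)) ≡ 2 + length T
length-1+M₁* {true ∷ t} (odd h _) = ≤-antisym upper (coef-true⇒<length S (2 + n) leading)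
  where
  n : ℕ
  n = length t
  T : Poly
  T = true ∷ t
  S : Poly
  S = 𝟙 ⊕ (M₁ ⊗ T)
  upper : length S ≤ 3 + n
  upper = ≤-trans (length-norm (addRaw 𝟙 (M₁ ⊗ T)))
            (length-addRaw 𝟙 (M₁ ⊗ T) (s≤s z≤n)
              (≤-trans (length-norm (mulRaw M₁ T)) (length-mulRaw M₁ true t)))
  leading : coef S (2 + n) ≡ true
  leading = begin
    coef S (2 + n)                                  ≡⟨ coef-⊕ 𝟙 (M₁ ⊗ T) (2 + n) ⟩
    coef (M₁ ⊗ T) (2 + n)                           ≡⟨ coef-norm (mulRaw M₁ T) (2 + n) ⟩
    coef (mulRaw M₁ T) (2 + n)                      ≡⟨ coef-M₁* T n ⟩
    coef t (1 + n) xor (coef t n xor coef T n)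
      ≡⟨ cong₂ (λ c d → c xor (d xor coef T n)) (coef-≥length t (1 + n) (n≤1+n n)) (coef-≥length t n ≤-refl) ⟩
    coef T n                                        ≡⟨ coef-leading h ⟩
    true                                            ∎
    where open ≡-Reasoning

nonZero-1+M₁* : ∀ {T} → Odd T → NonZeroPoly (𝟙 ⊕ (M₁ ⊗ T))
nonZero-1+M₁* {T} T-odd eq
  with () ← trans (sym (length-1+M₁* T-odd)) (cong length (trans (sym (norm-idem (addRaw 𝟙 (M₁ ⊗ T)))) eq))

length-oddPart-1+M₁* : ∀ {T} → Odd T → length (oddPart (𝟙 ⊕ (M₁ ⊗ T))) ≤ length T
length-oddPart-1+M₁* {T} T-odd = +-cancelˡ-≤ 2 (length (oddPart S)) (length T) (begin
  2 + length (oddPart S)             ≡⟨ +-comm 2 (length (oddPart S)) ⟩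
  length (oddPart S) + 2             ≡⟨ +-assoc (length (oddPart S)) 1 1 ⟨
  length (oddPart S) + 1 + 1         ≤⟨ +-mono-≤ (+-monoʳ-≤ (length (oddPart S)) x+1∣S) x∣S ⟩
  length (oddPart S) + valX1 S + valX S ≤⟨ OddPart.length-oddPart S S≢0 ⟩
  length (norm S)                    ≡⟨ cong length (norm-idem (addRaw 𝟙 (M₁ ⊗ T))) ⟩
  length S                           ≡⟨ length-1+M₁* T-odd ⟩
  2 + length T                       ∎)
  where
  open ≤-Reasoning
  S : Poly
  S = 𝟙 ⊕ (M₁ ⊗ T)
  S≢0 : NonZeroPoly S
  S≢0 = nonZero-1+M₁* T-odd
  x∣S : 1 ≤ valX S
  x∣S = valX-pos (normal-norm (addRaw 𝟙 (M₁ ⊗ T))) S≢0 (coef₀-1+M₁* T-odd)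
  x+1∣S : 1 ≤ valX1 S
  x+1∣S = valX1-pos (normal-norm (addRaw 𝟙 (M₁ ⊗ T))) S≢0 (parity-1+M₁* T-odd)

length-odd : ∀ {T} → Odd T → length T ≡ suc (deg T)
length-odd (odd h _) = cong suc (sym (cong (λ r → length r ∸ 1) (norm-normal h)))

deg-1+M₁* : ∀ {T} → Odd T → deg (𝟙 ⊕ (M₁ ⊗ T)) ≡ deg T + 2
deg-1+M₁* {T} T-odd = begin
  deg S                 ≡⟨⟩
  length (norm S) ∸ 1   ≡⟨ cong (λ r → length r ∸ 1) (norm-idem (addRaw 𝟙 (M₁ ⊗ T))) ⟩
  length S ∸ 1          ≡⟨ cong (_∸ 1) (length-1+M₁* T-odd) ⟩
  1 + length T          ≡⟨ cong suc (length-odd T-odd) ⟩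
  2 + deg T             ≡⟨ +-comm 2 (deg T) ⟩
  deg T + 2             ∎
  where
  open ≡-Reasoning
  S : Poly
  S = 𝟙 ⊕ (M₁ ⊗ T)

deg-oddPart-1+M₁* : ∀ {T} → Odd T → deg (oddPart (𝟙 ⊕ (M₁ ⊗ T))) ≤ deg T
deg-oddPart-1+M₁* {T} T-odd = ≤-pred (begin
  suc (deg O)  ≡⟨ length-odd O-odd ⟨
  length O     ≤⟨ length-oddPart-1+M₁* T-odd ⟩
  length T     ≡⟨ length-odd T-odd ⟩
  suc (deg T)  ∎)
  where
  open ≤-Reasoning
  O : Poly
  O = oddPart (𝟙 ⊕ (M₁ ⊗ T))
  O-odd : Odd O
  O-odd = OddPart.odd-oddPart (𝟙 ⊕ (M₁ ⊗ T)) (nonZero-1+M₁* T-odd)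

stepwise-antitone : ∀ (u : ℕ → ℕ) → (∀ k → u (suc k) ≤ u k) → ∀ {m n} → m ≤ n → u n ≤ u m
stepwise-antitone u u-step {n = zero}  z≤n = ≤-refl
stepwise-antitone u u-step {n = suc n} m≤1+n with m≤n⇒m<n∨m≡n m≤1+n
... | inj₁ m<1+n = ≤-trans (u-step n) (stepwise-antitone u u-step (≤-pred m<1+n))
... | inj₂ refl  = ≤-refl

module Orbit {X : Set} (F : X → X) (s : ℕ → X) (s-suc : ∀ k → s (suc k) ≡ F (s k)) where

  shift : ∀ {i j} → s i ≡ s j → ∀ m → s (m + i) ≡ s (m + j)
  shift         eq zero    = eq
  shift {i} {j} eq (suc m) =
    trans (s-suc (m + i)) (trans (cong F (shift eq m)) (sym (s-suc (m + j))))

  periodic : ∀ {i q} → s i ≡ s (q + i) → ∀ t → s (t * q + i) ≡ s i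
  periodic         _  zero    = refl
  periodic {i} {q} eq (suc t) = begin
    s (q + t * q + i)   ≡⟨ cong s (trans (cong (_+ i) (+-comm q (t * q))) (+-assoc (t * q) q i)) ⟩
    s (t * q + (q + i)) ≡⟨ shift eq (t * q) ⟨
    s (t * q + i)       ≡⟨ periodic eq t ⟩
    s i                 ∎
    where open ≡-Reasoning

  measure-stabilises : (μ : X → ℕ) → (∀ k → μ (s (suc k)) ≤ μ (s k)) →
                       ∀ {i j} → i < j → s i ≡ s j → ∀ k → i ≤ k → μ (s k) ≡ μ (s i)
  measure-stabilises μ μ-step {i} {j} i<j repetition k i≤k =
    ≤-antisym (antitone i≤k) (begin
      μ (s i)           ≡⟨ cong μ (periodic recurrence k) ⟨
      μ (s (k * q + i)) ≤⟨ antitone k≤kq+i ⟩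
      μ (s k)           ∎)
    where
    open ≤-Reasoning
    antitone : ∀ {m n} → m ≤ n → μ (s n) ≤ μ (s m)
    antitone = stepwise-antitone (λ k → μ (s k)) μ-step
    q : ℕ
    q = j ∸ i
    recurrence : s i ≡ s (q + i)
    recurrence = trans repetition (cong s (sym (m∸n+n≡m (<⇒≤ i<j))))
    k≤kq+i : k ≤ k * q + i
    k≤kq+i = ≤-trans (≤-trans (≤-reflexive (sym (*-identityʳ k))) (*-monoʳ-≤ k (m<n⇒0<n∸m i<j)))
                     (m≤m+n (k * q) i)

bounded-repeats : ∀ {B} (c : ℕ → ℕ) → (∀ k → c k < B) → ∃[ i ] ∃[ j ] i < j × c i ≡ c j
bounded-repeats {B} c c<B with pigeonhole (n<1+n B) (λ i → fromℕ< (c<B (toℕ i)))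
... | i , j , i<j , same =
  toℕ i , toℕ j , i<j ,
  trans (sym (toℕ-fromℕ< (c<B (toℕ i)))) (trans (cong toℕ same) (toℕ-fromℕ< (c<B (toℕ j))))

bit : Bool → ℕ
bit false = 0
bit true  = 1

code : Poly → ℕ
code []      = 0
code (b ∷ p) = bit b + code p * 2

bit<2 : ∀ b → bit b < 2
bit<2 false = s≤s z≤n
bit<2 true  = s≤s (s≤s z≤n)

code-< : ∀ p → code p < 2 ^ length p
code-< []      = s≤s z≤n
code-< (b ∷ p) = begin-strict
  bit b + code p * 2   <⟨ +-monoˡ-< (code p * 2) (bit<2 b) ⟩
  suc (code p) * 2     ≤⟨ *-monoˡ-≤ 2 (code-< p) ⟩
  2 ^ length p * 2     ≡⟨ *-comm (2 ^ length p) 2 ⟩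
  2 ^ length (b ∷ p)   ∎
  where open ≤-Reasoning

code-∷-injective : ∀ {a b p q} → code (a ∷ p) ≡ code (b ∷ q) → a ≡ b × code p ≡ code q
code-∷-injective {a} {b} {p} {q} eq =
  bit-injective a b lowest-digits ,
  *-cancelʳ-≡ (code p) (code q) 2
    (+-cancelˡ-≡ (bit a) (code p * 2) (code q * 2)
      (trans eq (cong (_+ code q * 2) (sym lowest-digits))))
  where
  bit%2 : ∀ b n → (bit b + n * 2) % 2 ≡ bit b
  bit%2 b n = trans ([m+kn]%n≡m%n (bit b) n 2) (m<n⇒m%n≡m (bit<2 b))
  lowest-digits : bit a ≡ bit b
  lowest-digits = trans (sym (bit%2 a (code p))) (trans (cong (_% 2) eq) (bit%2 b (code q)))
  bit-injective : ∀ a b → bit a ≡ bit b → a ≡ b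
  bit-injective false false _ = refl
  bit-injective true  true  _ = refl

code≡0 : ∀ p → code p ≡ 0 → norm p ≡ []
code≡0 []      _  = refl
code≡0 (b ∷ p) eq with code-∷-injective {b} {false} {p} {[]} eq
... | refl , p≡0 = cong (cons′ false) (code≡0 p p≡0)

code-injective : ∀ p q → code p ≡ code q → norm p ≡ norm q
code-injective []      q       eq = sym (code≡0 q (sym eq))
code-injective (a ∷ p) []      eq = code≡0 (a ∷ p) eq
code-injective (a ∷ p) (b ∷ q) eq with code-∷-injective {a} {b} {p} {q} eq
... | refl , p≡q = cong (cons′ a) (code-injective p q p≡q)

module CollatzDegrees (A : Poly) (A≢0 : NonZeroPoly A) where

  odd-oddTerm      : ∀ k → Odd (oddTerm A k)
  nonZero-evenTerm : ∀ k → NonZeroPoly (evenTerm A k)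
  odd-oddTerm k            = OddPart.odd-oddPart (evenTerm A k) (nonZero-evenTerm k)
  nonZero-evenTerm zero    = nonZero-norm {A} A≢0
  nonZero-evenTerm (suc k) = nonZero-1+M₁* (odd-oddTerm k)

  deg-oddTerm-suc : ∀ k → deg (oddTerm A (suc k)) ≤ deg (oddTerm A k)
  deg-oddTerm-suc k = deg-oddPart-1+M₁* (odd-oddTerm k)

  deg-evenTerm-suc : ∀ k → deg (evenTerm A (suc k)) ≡ deg (oddTerm A k) + 2
  deg-evenTerm-suc k = deg-1+M₁* (odd-oddTerm k)

  code-oddTerm-< : ∀ k → code (oddTerm A k) < 2 ^ suc (deg (oddTerm A 0))
  code-oddTerm-< k = begin-strict
    code (oddTerm A k)          <⟨ code-< (oddTerm A k) ⟩
    2 ^ length (oddTerm A k)    ≡⟨ cong (2 ^_) (length-odd (odd-oddTerm k)) ⟩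
    2 ^ suc (deg (oddTerm A k)) ≤⟨ ^-monoʳ-≤ 2 (s≤s (stepwise-antitone (λ k → deg (oddTerm A k)) deg-oddTerm-suc {0} {k} z≤n)) ⟩
    2 ^ suc (deg (oddTerm A 0)) ∎
    where open ≤-Reasoning

  oddTerm-repeats : ∃[ i ] ∃[ j ] i < j × oddTerm A i ≡ oddTerm A j
  oddTerm-repeats =
    let i , j , i<j , same = bounded-repeats (λ k → code (oddTerm A k)) code-oddTerm-<
    in  i , j , i<j , (begin
          oddTerm A i          ≡⟨ norm-normal (normal-odd (odd-oddTerm i)) ⟨
          norm (oddTerm A i)   ≡⟨ code-injective (oddTerm A i) (oddTerm A j) same ⟩
          norm (oddTerm A j)   ≡⟨ norm-normal (normal-odd (odd-oddTerm j)) ⟩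
          oddTerm A j          ∎)
    where open ≡-Reasoning

  deg-oddTerm-stable : ∃[ N ] (∀ k → N ≤ k → deg (oddTerm A k) ≡ deg (oddTerm A N))
  deg-oddTerm-stable =
    let i , _ , i<j , repetition = oddTerm-repeats
    in  i , Orbit.measure-stabilises (λ T → oddPart (𝟙 ⊕ (M₁ ⊗ T))) (oddTerm A) (λ _ → refl)
                                     deg deg-oddTerm-suc i<j repetition

corollary2p4 : (A : Poly) → NonZeroPoly A →
    ∃[ ℓ ] ∃[ d ] (ConvergesTo (λ k → deg (oddTerm A k)) ℓ
    × ConvergesTo (λ k → deg (evenTerm A k)) d
    × d ≡ ℓ + 2)
corollary2p4 A A≢0 = ℓ , ℓ + 2 , (N , oddStable) , (suc N , evenStable) , refl
  where
  open CollatzDegrees A A≢0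
  N : ℕ
  N = proj₁ deg-oddTerm-stable
  ℓ : ℕ
  ℓ = deg (oddTerm A N)
  oddStable : ∀ k → N ≤ k → deg (oddTerm A k) ≡ ℓ
  oddStable = proj₂ deg-oddTerm-stable
  evenStable : ∀ k → suc N ≤ k → deg (evenTerm A k) ≡ ℓ + 2
  evenStable (suc k) (s≤s N≤k) = trans (deg-evenTerm-suc k) (cong (_+ 2) (oddStable k N≤k))
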